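{- In the forward-march model described in the context, for every permutation $\pi$ that is not the identity and every forward-march prefix transposition $\tau$ applicable to $\pi$, $b_{FM}(\pi)-b_{FM}(\pi\cdot\tau)\le 3$.
   Context: A permutation is $\pi=[\pi_0,\pi_1,\ldots,\pi_n,\pi_{n+1}]$ with $\pi_0=0$, $\pi_{n+1}=n+1$ and $(\pi_1,\ldots,\pi_n)$ a permutation of $\{1,\ldots,n\}$; the identity has $\pi_i=i$ for all $i$. Let $s(\pi)$ be the largest $s\in\{0,\ldots,n+1\}$ with $\pi_k=k$ for all $0\le k\le s$. If $\pi$ is not the identity and $s=s(\pi)$, a forward-march prefix transposition, for some $s+2\le j\le n$ and $j<k\le n+1$, transforms $\pi$ into $[\pi_0,\ldots,\pi_s,\pi_j,\ldots,\pi_{k-1},\pi_{s+1},\ldots,\pi_{j-1},\pi_k,\ldots,\pi_{n+1}]$. $b_{FM}(\pi)$ is the number of indices $i$ with $s(\pi)\le i\le n$ and $|\pi_{i+1}-\pi_i|\neq1$ (computed with the sorted prefix of the permutation in question). -}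

module Defs where

open import Data.Nat using (ℕ; zero; suc; _+_; _∸_; _≤_; _<_; _≡ᵇ_; ∣_-_∣)
open import Data.Bool using (Bool; true; false; if_then_else_)
open import Data.List using (List; []; _∷_; _++_; take; drop; upTo; length)
open import Data.List.Relation.Binary.Permutation.Propositional using (_↭_)
open import Data.Product using (_×_)
open import Relation.Binary.PropositionalEquality using (_≡_)

-- An (extended) permutation of size n is a list [π₀, π₁, …, πₙ, πₙ₊₁]
-- of length n+2 which is a rearrangement of 0,1,…,n+1 with π₀ = 0 and πₙ₊₁ = n+1.
-- Indexing π_i is `at π i` (0-based; default 0 outside the range, never used).
at : List ℕ → ℕ → ℕ
at []       _       = 0
at (x ∷ _)  zero    = x
at (_ ∷ xs) (suc i) = at xs i

IsPerm : ℕ → List ℕ → Set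
IsPerm n π = (π ↭ upTo (suc (suc n))) × (at π 0 ≡ 0) × (at π (suc n) ≡ suc n)

identity : ℕ → List ℕ
identity n = upTo (suc (suc n))

fixedRun : ℕ → List ℕ → ℕ
fixedRun i []       = 0
fixedRun i (x ∷ xs) = if x ≡ᵇ i then suc (fixedRun (suc i) xs) else 0

-- s(π): largest s with π_k = k for all 0 ≤ k ≤ s (π₀ = 0 always holds).
sortedPrefix : List ℕ → ℕ
sortedPrefix π = fixedRun 0 π ∸ 1

slice : ℕ → ℕ → List ℕ → List ℕ
slice a b π = take (b ∸ a) (drop a π)

fmTransposition : ℕ → ℕ → List ℕ → List ℕ
fmTransposition j k π =
  take (suc s) π ++ slice j k π ++ slice (suc s) j π ++ drop k π
  where s = sortedPrefix π

isBreak : List ℕ → ℕ → Bool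
isBreak π i = if ∣ at π (suc i) - at π i ∣ ≡ᵇ 1 then false else true

countBreaks : List ℕ → ℕ → ℕ → ℕ
countBreaks π lo zero    = 0
countBreaks π lo (suc m) =
  (if isBreak π lo then 1 else 0) + countBreaks π (suc lo) m

bFM : ℕ → List ℕ → ℕ
bFM n π = countBreaks π (sortedPrefix π) (suc n ∸ sortedPrefix π)

-- Breakpoints inside the sorted prefix 0, 1, …, s are never breakpoints, so b_FM(π) is the
-- total number of breakpoints of π, for π as well as for π·τ (both start with π₀ = 0).
-- Writing π = T A B C with the blocks T = π₀…π_s, A = π_{s+1}…π_{j−1}, B = π_j…π_{k−1} and
-- C = π_k…π_{n+1}, all nonempty, the transposition yields T B A C.  The breakpoints inside
-- the blocks are the same in both, and π has only the three junctions T|A, A|B, B|C besides,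
-- each contributing at most one breakpoint.
module Submission where

open import Defs
open import Data.Nat using (ℕ; zero; suc; _+_; _∸_; _≤_; _<_; _≡ᵇ_; ∣_-_∣; z≤n; s≤s; s≤s⁻¹)
open import Data.Nat.Properties
open import Data.Nat.Tactic.RingSolver using (solve-∀)
open import Data.Bool using (true; false; if_then_else_)
open import Data.Bool.Properties using (T-≡)
open import Data.List using (List; []; _∷_; _++_; take; drop; length)
open import Data.List.Properties using (length-drop; length-upTo; take++drop≡id; drop-drop)
open import Data.List.Relation.Binary.Permutation.Propositional.Properties using (↭-length; ++⁺ˡ; shifts)
open import Data.Product using (_,_)
open import Data.Empty using (⊥-elim)
open import Function.Bundles using (Equivalence)
open import Relation.Binary.PropositionalEquality
open import Relation.Nullary using (¬_)

break : ℕ → ℕ → ℕ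
break x y = if ∣ y - x ∣ ≡ᵇ 1 then 0 else 1

breaksFrom : ℕ → List ℕ → ℕ
breaksFrom x []       = 0
breaksFrom x (y ∷ ys) = break x y + breaksFrom y ys

breaks : List ℕ → ℕ
breaks []       = 0
breaks (x ∷ xs) = breaksFrom x xs

lastOr : ℕ → List ℕ → ℕ
lastOr x []       = x
lastOr x (y ∷ ys) = lastOr y ys

break≤1 : ∀ x y → break x y ≤ 1
break≤1 x y with ∣ y - x ∣ ≡ᵇ 1
... | true  = z≤n
... | false = ≤-refl

∣suc-n-n∣≡1 : ∀ n → ∣ suc n - n ∣ ≡ 1
∣suc-n-n∣≡1 zero    = refl
∣suc-n-n∣≡1 (suc n) = ∣suc-n-n∣≡1 n

break-suc : ∀ x → break x (suc x) ≡ 0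
break-suc x rewrite ∣suc-n-n∣≡1 x = refl

breaksFrom-++ : ∀ x xs y ys →
  breaksFrom x (xs ++ y ∷ ys) ≡ breaksFrom x xs + break (lastOr x xs) y + breaksFrom y ys
breaksFrom-++ x []       y ys = refl
breaksFrom-++ x (z ∷ xs) y ys = begin
  break x z + breaksFrom z (xs ++ y ∷ ys)
    ≡⟨ cong (break x z +_) (breaksFrom-++ z xs y ys) ⟩
  break x z + (breaksFrom z xs + break (lastOr z xs) y + breaksFrom y ys)
    ≡⟨ +-assoc (break x z) _ _ ⟨
  break x z + (breaksFrom z xs + break (lastOr z xs) y) + breaksFrom y ys
    ≡⟨ cong (_+ breaksFrom y ys) (+-assoc (break x z) _ _) ⟨
  break x z + breaksFrom z xs + break (lastOr z xs) y + breaksFrom y ys ∎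
  where open ≡-Reasoning

breaksFrom-blocks : ∀ x a as b bs c cs →
  breaksFrom x ((a ∷ as) ++ (b ∷ bs) ++ c ∷ cs) ≡
  (break x a + break (lastOr a as) b + break (lastOr b bs) c) +
  (breaksFrom a as + breaksFrom b bs + breaksFrom c cs)
breaksFrom-blocks x a as b bs c cs = begin
  breaksFrom x ((a ∷ as) ++ (b ∷ bs) ++ c ∷ cs)
    ≡⟨ breaksFrom-++ x (a ∷ as) b (bs ++ c ∷ cs) ⟩
  break x a + breaksFrom a as + break (lastOr a as) b + breaksFrom b (bs ++ c ∷ cs)
    ≡⟨ cong (break x a + breaksFrom a as + break (lastOr a as) b +_) (breaksFrom-++ b bs c cs) ⟩
  break x a + breaksFrom a as + break (lastOr a as) b +
    (breaksFrom b bs + break (lastOr b bs) c + breaksFrom c cs)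
    ≡⟨ regroup (break x a) (breaksFrom a as) (break (lastOr a as) b) _ _ _ ⟩
  (break x a + break (lastOr a as) b + break (lastOr b bs) c) +
  (breaksFrom a as + breaksFrom b bs + breaksFrom c cs) ∎
  where
  open ≡-Reasoning
  regroup : ∀ p u q v r w → p + u + q + (v + r + w) ≡ (p + q + r) + (u + v + w)
  regroup = solve-∀

breaksFrom-swap : ∀ x ws xs ys zs → 0 < length xs → 0 < length ys → 0 < length zs →
  breaksFrom x (ws ++ xs ++ ys ++ zs) ≤ breaksFrom x (ws ++ ys ++ xs ++ zs) + 3
breaksFrom-swap x (w ∷ ws) xs ys zs xs≢[] ys≢[] zs≢[] = begin
  break x w + breaksFrom w (ws ++ xs ++ ys ++ zs)
    ≤⟨ +-monoʳ-≤ (break x w) (breaksFrom-swap w ws xs ys zs xs≢[] ys≢[] zs≢[]) ⟩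
  break x w + (breaksFrom w (ws ++ ys ++ xs ++ zs) + 3)
    ≡⟨ +-assoc (break x w) _ 3 ⟨
  break x w + breaksFrom w (ws ++ ys ++ xs ++ zs) + 3 ∎
  where open ≤-Reasoning
breaksFrom-swap x [] (a ∷ as) (b ∷ bs) (c ∷ cs) _ _ _ = begin
  breaksFrom x ((a ∷ as) ++ (b ∷ bs) ++ c ∷ cs) ≡⟨ breaksFrom-blocks x a as b bs c cs ⟩
  junctions + (α + β + γ)                       ≤⟨ +-monoˡ-≤ (α + β + γ) junctions≤3 ⟩
  3 + (α + β + γ)                               ≡⟨ cong (λ t → 3 + (t + γ)) (+-comm α β) ⟩
  3 + (β + α + γ)                               ≤⟨ +-monoʳ-≤ 3 (m≤n+m (β + α + γ) junctions′) ⟩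
  3 + (junctions′ + (β + α + γ))                ≡⟨ +-comm 3 _ ⟩
  junctions′ + (β + α + γ) + 3                  ≡⟨ cong (_+ 3) (breaksFrom-blocks x b bs a as c cs) ⟨
  breaksFrom x ((b ∷ bs) ++ (a ∷ as) ++ c ∷ cs) + 3 ∎
  where
  open ≤-Reasoning
  α β γ junctions junctions′ : ℕ
  α = breaksFrom a as
  β = breaksFrom b bs
  γ = breaksFrom c cs
  junctions = break x a + break (lastOr a as) b + break (lastOr b bs) c
  junctions′ = break x b + break (lastOr b bs) a + break (lastOr a as) c
  junctions≤3 : junctions ≤ 3
  junctions≤3 = +-mono-≤ (+-mono-≤ (break≤1 x a) (break≤1 (lastOr a as) b)) (break≤1 (lastOr b bs) c)

breaks-swap : ∀ ws xs ys zs →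
  0 < length ws → 0 < length xs → 0 < length ys → 0 < length zs →
  breaks (ws ++ xs ++ ys ++ zs) ≤ breaks (ws ++ ys ++ xs ++ zs) + 3
breaks-swap (w ∷ ws) xs ys zs _ = breaksFrom-swap w ws xs ys zs

breaksFrom-fixedRun : ∀ x xs → 0 < fixedRun (suc x) xs → breaksFrom x xs ≡ breaks xs
breaksFrom-fixedRun x (y ∷ ys) run with y ≡ᵇ suc x in y≡ᵇx+1
... | false = ⊥-elim (n≮0 run)
... | true rewrite ≡ᵇ⇒≡ y (suc x) (Equivalence.from T-≡ y≡ᵇx+1) =
  cong (_+ breaksFrom (suc x) ys) (break-suc x)

breaks-drop-fixedRun : ∀ i l d → d < fixedRun i l → breaks (drop d l) ≡ breaks l
breaks-drop-fixedRun i l        zero    _   = refl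
breaks-drop-fixedRun i (x ∷ xs) (suc d) run with x ≡ᵇ i in x≡ᵇi
... | false = ⊥-elim (n≮0 run)
... | true with refl ← ≡ᵇ⇒≡ x i (Equivalence.from T-≡ x≡ᵇi) = begin
  breaks (drop d xs) ≡⟨ breaks-drop-fixedRun (suc i) xs d (s≤s⁻¹ run) ⟩
  breaks xs          ≡⟨ breaksFrom-fixedRun i xs (≤-trans (s≤s z≤n) (s≤s⁻¹ run)) ⟨
  breaksFrom i xs    ∎
  where open ≡-Reasoning

fixedRun≤length : ∀ i l → fixedRun i l ≤ length l
fixedRun≤length i []       = z≤n
fixedRun≤length i (x ∷ xs) with x ≡ᵇ i
... | true  = s≤s (fixedRun≤length (suc i) xs)
... | false = z≤n

0<fixedRun : ∀ {i} l → at l 0 ≡ i → 0 < length l → 0 < fixedRun i l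
0<fixedRun {i} (x ∷ xs) x≡i _ with x ≡ᵇ i | ≡⇒≡ᵇ x i x≡i
... | true | _ = s≤s z≤n

0<fixedRun-take-++ : ∀ {i} m l ys → 0 < fixedRun i l → 0 < fixedRun i (take (suc m) l ++ ys)
0<fixedRun-take-++ {i} m (x ∷ xs) ys run with x ≡ᵇ i
... | true  = s≤s z≤n
... | false = run

countBreaks-[] : ∀ lo m → countBreaks [] lo m ≡ m
countBreaks-[] lo zero    = refl
countBreaks-[] lo (suc m) = cong suc (countBreaks-[] (suc lo) m)

countBreaks-∷ : ∀ x xs lo m → countBreaks (x ∷ xs) (suc lo) m ≡ countBreaks xs lo m
countBreaks-∷ x xs lo zero    = refl
countBreaks-∷ x xs lo (suc m) = cong (_ +_) (countBreaks-∷ x xs (suc lo) m)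

countBreaks-drop : ∀ l lo m → countBreaks l lo m ≡ countBreaks (drop lo l) 0 m
countBreaks-drop l        zero     m = refl
countBreaks-drop []       (suc lo) m = trans (countBreaks-[] (suc lo) m) (sym (countBreaks-[] 0 m))
countBreaks-drop (x ∷ xs) (suc lo) m = trans (countBreaks-∷ x xs lo m) (countBreaks-drop xs lo m)

countBreaks≡breaks : ∀ l m → length l ≡ suc m → countBreaks l 0 m ≡ breaks l
countBreaks≡breaks (x ∷ [])    zero    _   = refl
countBreaks≡breaks (x ∷ y ∷ r) (suc m) len with ∣ y - x ∣ ≡ᵇ 1
... | true  = trans (countBreaks-∷ x (y ∷ r) 0 m) (countBreaks≡breaks (y ∷ r) m (suc-injective len))
... | false = cong suc (trans (countBreaks-∷ x (y ∷ r) 0 m) (countBreaks≡breaks (y ∷ r) m (suc-injective len)))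

bFM≡breaks : ∀ n π → length π ≡ suc (suc n) → 0 < fixedRun 0 π → bFM n π ≡ breaks π
bFM≡breaks n π len run = begin
  countBreaks π s (suc n ∸ s)          ≡⟨ countBreaks-drop π s (suc n ∸ s) ⟩
  countBreaks (drop s π) 0 (suc n ∸ s) ≡⟨ countBreaks≡breaks (drop s π) (suc n ∸ s) len-drop ⟩
  breaks (drop s π)                    ≡⟨ breaks-drop-fixedRun 0 π s (m∸1<m run) ⟩
  breaks π                             ∎
  where
  open ≡-Reasoning
  s : ℕ
  s = sortedPrefix π
  m∸1<m : ∀ {m} → 0 < m → m ∸ 1 < m
  m∸1<m {suc m} _ = ≤-refl
  s≤n+1 : s ≤ suc n
  s≤n+1 = subst (λ m → s ≤ m ∸ 1) len (∸-monoˡ-≤ 1 (fixedRun≤length 0 π))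
  len-drop : length (drop s π) ≡ suc (suc n ∸ s)
  len-drop = trans (length-drop s π) (trans (cong (_∸ s) len) (+-∸-assoc 1 s≤n+1))

module _ {A : Set} where

  0<length-take : ∀ m (l : List A) → 0 < m → 0 < length l → 0 < length (take m l)
  0<length-take (suc m) (x ∷ l) _ _ = s≤s z≤n

  0<length-drop : ∀ a (l : List A) → a < length l → 0 < length (drop a l)
  0<length-drop a l a<len = subst (0 <_) (sym (length-drop a l)) (m<n⇒0<n∸m a<len)

0<length-slice : ∀ a b (l : List ℕ) → a < b → a < length l → 0 < length (slice a b l)
0<length-slice a b l a<b a<len =
  0<length-take (b ∸ a) (drop a l) (m<n⇒0<n∸m a<b) (0<length-drop a l a<len)

drop≡slice++drop : ∀ a b (l : List ℕ) → a ≤ b → drop a l ≡ slice a b l ++ drop b l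
drop≡slice++drop a b l a≤b = begin
  drop a l                               ≡⟨ take++drop≡id (b ∸ a) (drop a l) ⟨
  slice a b l ++ drop (b ∸ a) (drop a l) ≡⟨ cong (slice a b l ++_) (drop-drop a (b ∸ a) l) ⟩
  slice a b l ++ drop (a + (b ∸ a)) l    ≡⟨ cong (λ m → slice a b l ++ drop m l) (m+[n∸m]≡n a≤b) ⟩
  slice a b l ++ drop b l                ∎
  where open ≡-Reasoning

take++slice++slice++drop≡id : ∀ a b c (l : List ℕ) → a ≤ b → b ≤ c →
  take a l ++ slice a b l ++ slice b c l ++ drop c l ≡ l
take++slice++slice++drop≡id a b c l a≤b b≤c = begin
  take a l ++ slice a b l ++ slice b c l ++ drop c l
    ≡⟨ cong (λ r → take a l ++ slice a b l ++ r) (drop≡slice++drop b c l b≤c) ⟨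
  take a l ++ slice a b l ++ drop b l
    ≡⟨ cong (take a l ++_) (drop≡slice++drop a b l a≤b) ⟨
  take a l ++ drop a l
    ≡⟨ take++drop≡id a l ⟩
  l ∎
  where open ≡-Reasoning

lemma10 : (n : ℕ) (π : List ℕ) → IsPerm n π → ¬ (π ≡ identity n) →
          (j k : ℕ) → suc (suc (sortedPrefix π)) ≤ j → j ≤ n → j < k → k ≤ suc n →
          bFM n π ≤ bFM n (fmTransposition j k π) + 3
lemma10 n π (π↭id , π₀≡0 , _) _ j k s+2≤j j≤n j<k k≤n+1 = begin
  bFM n π                   ≡⟨ bFM≡breaks n π |π| runπ ⟩
  breaks π                  ≡⟨ cong breaks blocks ⟨
  breaks (T ++ A ++ B ++ C) ≤⟨ breaks-swap T A B C T≢[] A≢[] B≢[] C≢[] ⟩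
  breaks σ + 3              ≡⟨ cong (_+ 3) (bFM≡breaks n σ |σ| runσ) ⟨
  bFM n σ + 3               ∎
  where
  open ≤-Reasoning
  s : ℕ
  s = sortedPrefix π
  T A B C σ : List ℕ
  T = take (suc s) π
  A = slice (suc s) j π
  B = slice j k π
  C = drop k π
  σ = fmTransposition j k π
  blocks : T ++ A ++ B ++ C ≡ π
  blocks = take++slice++slice++drop≡id (suc s) j k π (<⇒≤ s+2≤j) (<⇒≤ j<k)
  |π| : length π ≡ suc (suc n)
  |π| = trans (↭-length π↭id) (length-upTo (suc (suc n)))
  |σ| : length σ ≡ suc (suc n)
  |σ| = trans (↭-length (++⁺ˡ T (shifts B A))) (trans (cong length blocks) |π|)
  index<|π| : ∀ {i} → i ≤ suc n → i < length π
  index<|π| i≤n+1 = subst (_ <_) (sym |π|) (s≤s i≤n+1)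
  runπ : 0 < fixedRun 0 π
  runπ = 0<fixedRun π π₀≡0 (index<|π| z≤n)
  runσ : 0 < fixedRun 0 σ
  runσ = 0<fixedRun-take-++ s π (B ++ A ++ C) runπ
  T≢[] : 0 < length T
  T≢[] = 0<length-take (suc s) π (s≤s z≤n) (index<|π| z≤n)
  A≢[] : 0 < length A
  A≢[] = 0<length-slice (suc s) j π s+2≤j (index<|π| (≤-trans (<⇒≤ s+2≤j) (m≤n⇒m≤1+n j≤n)))
  B≢[] : 0 < length B
  B≢[] = 0<length-slice j k π j<k (index<|π| (m≤n⇒m≤1+n j≤n))
  C≢[] : 0 < length C
  C≢[] = 0<length-drop k π (index<|π| k≤n+1)
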